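{- If $\Gamma\vdash_s M:A$ is derivable in the system $\Lambda_\cap^s$, then $M$ is strongly $\beta$-normalising.
   Context: $\lambda$-terms: $M::=x\mid MM\mid\lambda x.M$ modulo $\alpha$-conversion; $M[x:=N]$ is capture-avoiding substitution; $\beta$-reduction is the contextual closure of $(\lambda x.M)N\to M[x:=N]$; strongly normalising means every reduction sequence is finite. Types: $A::=\varphi\mid A\to A\mid A\cap A$. A typing context is a finite set of pairs $x:A$, where a variable may occur with several types; $\Gamma,x:A$ denotes $\Gamma\cup\{x:A\}$; $x\notin\Gamma$ means no $x:B$ lies in $\Gamma$. Rules of $\Lambda_\cap^s$ ($n\ge0$): (Ax) $\Gamma,x:A\vdash_s x:A$; $(\mathsf{Beta})^s$ from $\Gamma\vdash_s M[x:=N]N_1\dots N_n:A$ and $\Gamma\vdash_s N:B$ infer $\Gamma\vdash_s(\lambda x.M)NN_1\dots N_n:A$; $(\mathsf{L}\to)$ from $\Gamma\vdash_s N:A_1$ and $\Gamma,y:A_2\vdash_s yN_1\dots N_n:B$, with $y\notin FV(N_1)\cup\dots\cup FV(N_n)$ and $y\notin\Gamma$, infer $\Gamma,x:A_1\to A_2\vdash_s xNN_1\dots N_n:B$; $(\mathsf{R}\to)$ from $\Gamma,x:A\vdash_s M:B$, $x\notin\Gamma$, infer $\Gamma\vdash_s\lambda x.M:A\to B$; $(\mathsf{L}\cap)$ from $\Gamma,x:A_1,x:A_2\vdash_s xN_1\dots N_n:B$ infer $\Gamma,x:A_1\cap A_2\vdash_s xN_1\dots N_n:B$; $(\mathsf{R}\cap)$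 from $\Gamma\vdash_s M:A$ and $\Gamma\vdash_s M:B$ infer $\Gamma\vdash_s M:A\cap B$. -}

module Defs where

open import Data.Nat using (ℕ; zero; suc)
open import Data.Product using (_×_; _,_; proj₁)
open import Data.Sum using (_⊎_)
open import Data.List using (List; []; _∷_; map)
open import Data.List.Membership.Propositional using (_∈_)
open import Data.List.Relation.Unary.All using (All)
open import Data.List.Relation.Unary.Any using (Any)
open import Relation.Binary.PropositionalEquality using (_≡_)
open import Relation.Nullary using (¬_)

-- λ-terms modulo α-conversion: de Bruijn indices.
-- Free variables are the natural numbers (var n with n not bound).

infixl 7 _·_

data Term : Set where
  var : ℕ → Term
  _·_ : Term → Term → Term
  lam : Term → Term

apps : Term → List Term → Term
apps M []       = M
apps M (N ∷ Ns) = apps (M · N) Ns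

ext : (ℕ → ℕ) → ℕ → ℕ
ext ρ zero    = zero
ext ρ (suc n) = suc (ρ n)

rename : (ℕ → ℕ) → Term → Term
rename ρ (var x) = var (ρ x)
rename ρ (M · N) = rename ρ M · rename ρ N
rename ρ (lam M) = lam (rename (ext ρ) M)

exts : (ℕ → Term) → ℕ → Term
exts σ zero    = var zero
exts σ (suc n) = rename suc (σ n)

subst : (ℕ → Term) → Term → Term
subst σ (var x) = σ x
subst σ (M · N) = subst σ M · subst σ N
subst σ (lam M) = lam (subst (exts σ) M)

sub0 : Term → ℕ → Term
sub0 N zero    = N
sub0 N (suc n) = var n

_[_] : Term → Term → Term
M [ N ] = subst (sub0 N) M

Free : ℕ → Term → Set
Free x (var y) = x ≡ y
Free x (M · N) = Free x M ⊎ Free x N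
Free x (lam M) = Free (suc x) M

infix 4 _→β_

data _→β_ : Term → Term → Set where
  β    : ∀ {M N} → lam M · N →β M [ N ]
  appL : ∀ {M M′ N} → M →β M′ → M · N →β M′ · N
  appR : ∀ {M N N′} → N →β N′ → M · N →β M · N′
  abs  : ∀ {M M′} → M →β M′ → lam M →β lam M′

-- strongly normalising: inductively, every one-step reduct is SN
-- (accessibility; no infinite reduction sequence starts from M)
data SN (M : Term) : Set where
  sn : (∀ {N} → M →β N → SN N) → SN M

infixr 6 _⇒_
infixl 7 _∩_

data Ty : Set where
  φ   : ℕ → Ty
  _⇒_ : Ty → Ty → Ty
  _∩_ : Ty → Ty → Ty

-- Typing contexts: finite sets of pairs x : A, represented by lists
-- (a variable may occur with several types); set equality below.
Ctx : Set
Ctx = List (ℕ × Ty)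

_≈ₛ_ : Ctx → Ctx → Set
Δ ≈ₛ Γ = ∀ p → (p ∈ Δ → p ∈ Γ) × (p ∈ Γ → p ∈ Δ)

_∉dom_ : ℕ → Ctx → Set
x ∉dom Γ = ¬ Any (λ p → x ≡ proj₁ p) Γ

-- shift all variables of a context (going under a binder)
shiftCtx : Ctx → Ctx
shiftCtx = map (λ { (x , A) → (suc x , A) })

-- The system Λ∩ˢ.  A conclusion context "Γ , x : A" (= Γ ∪ {x : A})
-- is any list set-equal to (x , A) ∷ Γ.

infix 3 _⊢ₛ_∶_

data _⊢ₛ_∶_ : Ctx → Term → Ty → Set where
  Ax   : ∀ {Γ x A} → (x , A) ∈ Γ → Γ ⊢ₛ var x ∶ A
  Beta : ∀ {Γ M N Ns A B} →
         Γ ⊢ₛ apps (M [ N ]) Ns ∶ A →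
         Γ ⊢ₛ N ∶ B →
         Γ ⊢ₛ apps (lam M · N) Ns ∶ A
  L⇒   : ∀ {Γ Δ x y N Ns A₁ A₂ B} →
         Γ ⊢ₛ N ∶ A₁ →
         ((y , A₂) ∷ Γ) ⊢ₛ apps (var y) Ns ∶ B →
         All (λ Nᵢ → ¬ Free y Nᵢ) Ns →
         y ∉dom Γ →
         Δ ≈ₛ ((x , A₁ ⇒ A₂) ∷ Γ) →
         Δ ⊢ₛ apps (var x · N) Ns ∶ B
  R⇒   : ∀ {Γ M A B} →
         ((zero , A) ∷ shiftCtx Γ) ⊢ₛ M ∶ B →
         Γ ⊢ₛ lam M ∶ A ⇒ B
  L∩   : ∀ {Γ Δ x Ns A₁ A₂ B} →
         ((x , A₁) ∷ (x , A₂) ∷ Γ) ⊢ₛ apps (var x) Ns ∶ B →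
         Δ ≈ₛ ((x , A₁ ∩ A₂) ∷ Γ) →
         Δ ⊢ₛ apps (var x) Ns ∶ B
  R∩   : ∀ {Γ M A B} →
         Γ ⊢ₛ M ∶ A →
         Γ ⊢ₛ M ∶ B →
         Γ ⊢ₛ M ∶ A ∩ B

module Submission where

-- Induction on the derivation. Abstraction and
-- application of a variable to strongly normalising arguments preserve strong
-- normalisation, the intersection rules keep the subject, and (Beta) is covered
-- by closure of SN under head β-expansion, which holds because (Beta) also
-- types, hence normalises, the argument N that the contraction may erase.

open import Defs
open import Data.List using (List; []; _∷_)
open import Data.List.Relation.Unary.All using (All; []; _∷_)
open import Data.Nat using (zero; suc)
open import Data.Product using (_×_; _,_; proj₂)
open import Function using (_∘_)
open import Relation.Binary.Construct.Closure.ReflexiveTransitive using (Star; ε; _◅_; _◅◅_; gmap)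
open import Relation.Binary.PropositionalEquality using (_≡_; refl; sym; trans; cong; cong₂)
open Relation.Binary.PropositionalEquality.≡-Reasoning

infix 4 _→β*_ _→βₗ_

_→β*_ : Term → Term → Set
_→β*_ = Star _→β_

rename-cong : ∀ {ρ ρ′} → (∀ x → ρ x ≡ ρ′ x) → ∀ M → rename ρ M ≡ rename ρ′ M
rename-cong eq (var x) = cong var (eq x)
rename-cong eq (M · N) = cong₂ _·_ (rename-cong eq M) (rename-cong eq N)
rename-cong {ρ} {ρ′} eq (lam M) = cong lam (rename-cong ext-eq M)
  where
  ext-eq : ∀ x → ext ρ x ≡ ext ρ′ x
  ext-eq zero    = refl
  ext-eq (suc x) = cong suc (eq x)

subst-cong : ∀ {σ τ} → (∀ x → σ x ≡ τ x) → ∀ M → subst σ M ≡ subst τ M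
subst-cong eq (var x) = eq x
subst-cong eq (M · N) = cong₂ _·_ (subst-cong eq M) (subst-cong eq N)
subst-cong {σ} {τ} eq (lam M) = cong lam (subst-cong exts-eq M)
  where
  exts-eq : ∀ x → exts σ x ≡ exts τ x
  exts-eq zero    = refl
  exts-eq (suc x) = cong (rename suc) (eq x)

rename-∘ : ∀ ρ ρ′ M → rename ρ (rename ρ′ M) ≡ rename (ρ ∘ ρ′) M
rename-∘ ρ ρ′ (var x) = refl
rename-∘ ρ ρ′ (M · N) = cong₂ _·_ (rename-∘ ρ ρ′ M) (rename-∘ ρ ρ′ N)
rename-∘ ρ ρ′ (lam M) =
  cong lam (trans (rename-∘ (ext ρ) (ext ρ′) M) (rename-cong ext-∘ M))
  where
  ext-∘ : ∀ x → ext ρ (ext ρ′ x) ≡ ext (ρ ∘ ρ′) x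
  ext-∘ zero    = refl
  ext-∘ (suc x) = refl

rename-subst : ∀ ρ σ M → rename ρ (subst σ M) ≡ subst (rename ρ ∘ σ) M
rename-subst ρ σ (var x) = refl
rename-subst ρ σ (M · N) = cong₂ _·_ (rename-subst ρ σ M) (rename-subst ρ σ N)
rename-subst ρ σ (lam M) =
  cong lam (trans (rename-subst (ext ρ) (exts σ) M) (subst-cong ext-exts M))
  where
  ext-exts : ∀ x → rename (ext ρ) (exts σ x) ≡ exts (rename ρ ∘ σ) x
  ext-exts zero    = refl
  ext-exts (suc x) = trans (rename-∘ (ext ρ) suc (σ x)) (sym (rename-∘ suc ρ (σ x)))

subst-rename : ∀ σ ρ M → subst σ (rename ρ M) ≡ subst (σ ∘ ρ) M
subst-rename σ ρ (var x) = refl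
subst-rename σ ρ (M · N) = cong₂ _·_ (subst-rename σ ρ M) (subst-rename σ ρ N)
subst-rename σ ρ (lam M) =
  cong lam (trans (subst-rename (exts σ) (ext ρ) M) (subst-cong exts-ext M))
  where
  exts-ext : ∀ x → exts σ (ext ρ x) ≡ exts (σ ∘ ρ) x
  exts-ext zero    = refl
  exts-ext (suc x) = refl

subst-∘ : ∀ σ τ M → subst σ (subst τ M) ≡ subst (subst σ ∘ τ) M
subst-∘ σ τ (var x) = refl
subst-∘ σ τ (M · N) = cong₂ _·_ (subst-∘ σ τ M) (subst-∘ σ τ N)
subst-∘ σ τ (lam M) =
  cong lam (trans (subst-∘ (exts σ) (exts τ) M) (subst-cong exts-∘ M))
  where
  exts-∘ : ∀ x → subst (exts σ) (exts τ x) ≡ exts (subst σ ∘ τ) x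
  exts-∘ zero    = refl
  exts-∘ (suc x) = trans (subst-rename (exts σ) suc (τ x)) (sym (rename-subst suc σ (τ x)))

subst-id : ∀ M → subst var M ≡ M
subst-id (var x) = refl
subst-id (M · N) = cong₂ _·_ (subst-id M) (subst-id N)
subst-id (lam M) = cong lam (trans (subst-cong exts-var M) (subst-id M))
  where
  exts-var : ∀ x → exts var x ≡ var x
  exts-var zero    = refl
  exts-var (suc x) = refl

rename-as-subst : ∀ ρ M → rename ρ M ≡ subst (var ∘ ρ) M
rename-as-subst ρ M = trans (sym (subst-id (rename ρ M))) (subst-rename var ρ M)

subst-[] : ∀ σ M N → subst σ (M [ N ]) ≡ subst (exts σ) M [ subst σ N ]
subst-[] σ M N = begin
  subst σ (M [ N ])                           ≡⟨ subst-∘ σ (sub0 N) M ⟩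
  subst (subst σ ∘ sub0 N) M                  ≡⟨ subst-cong pointwise M ⟩
  subst (subst (sub0 (subst σ N)) ∘ exts σ) M ≡⟨ subst-∘ (sub0 (subst σ N)) (exts σ) M ⟨
  subst (exts σ) M [ subst σ N ]              ∎
  where
  pointwise : ∀ x → subst σ (sub0 N x) ≡ subst (sub0 (subst σ N)) (exts σ x)
  pointwise zero    = refl
  pointwise (suc x) =
    sym (trans (subst-rename (sub0 (subst σ N)) suc (σ x)) (subst-id (σ x)))

subst-→β : ∀ σ {M M′} → M →β M′ → subst σ M →β subst σ M′
subst-→β σ (β {M} {N}) rewrite subst-[] σ M N = β
subst-→β σ (appL r) = appL (subst-→β σ r)
subst-→β σ (appR r) = appR (subst-→β σ r)
subst-→β σ (abs r)  = abs (subst-→β (exts σ) r)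

rename-→β : ∀ ρ {M M′} → M →β M′ → rename ρ M →β rename ρ M′
rename-→β ρ {M} {M′} r rewrite rename-as-subst ρ M | rename-as-subst ρ M′ =
  subst-→β (var ∘ ρ) r

subst-→β* : ∀ {σ τ} → (∀ x → σ x →β* τ x) → ∀ M → subst σ M →β* subst τ M
subst-→β* rs (var x) = rs x
subst-→β* {σ} {τ} rs (M · N) =
  gmap (_· subst σ N) appL (subst-→β* rs M) ◅◅ gmap (subst τ M ·_) appR (subst-→β* rs N)
subst-→β* {σ} {τ} rs (lam M) = gmap lam abs (subst-→β* exts-→β* M)
  where
  exts-→β* : ∀ x → exts σ x →β* exts τ x
  exts-→β* zero    = ε
  exts-→β* (suc x) = gmap (rename suc) (rename-→β suc) (rs x)

data _→βₗ_ : List Term → List Term → Set where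
  here  : ∀ {N N′ Ns} → N →β N′ → N ∷ Ns →βₗ N′ ∷ Ns
  there : ∀ {N Ns Ns′} → Ns →βₗ Ns′ → N ∷ Ns →βₗ N ∷ Ns′

apps-→β-head : ∀ Ns {H H′} → H →β H′ → apps H Ns →β apps H′ Ns
apps-→β-head []       r = r
apps-→β-head (N ∷ Ns) r = apps-→β-head Ns (appL r)

apps-→β-args : ∀ H {Ns Ns′} → Ns →βₗ Ns′ → apps H Ns →β apps H Ns′
apps-→β-args H {_ ∷ Ns} (here r) = apps-→β-head Ns (appR r)
apps-→β-args H (there {N} rs)    = apps-→β-args (H · N) rs

data AppsReduct (H : Term) (Ns : List Term) : Term → Set where
  head : ∀ {H′} → H →β H′ → AppsReduct H Ns (apps H′ Ns)
  args : ∀ {Ns′} → Ns →βₗ Ns′ → AppsReduct H Ns (apps H Ns′)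

-- An application head cannot become a redex with the first argument.
apps-·-reduct : ∀ Ns {P Q T} → apps (P · Q) Ns →β T → AppsReduct (P · Q) Ns T
apps-·-reduct []       r = head r
apps-·-reduct (N ∷ Ns) r with apps-·-reduct Ns r
... | head (appL r′) = head r′
... | head (appR r′) = args (here r′)
... | args rs        = args (there rs)

SN-→β* : ∀ {M M′} → SN M → M →β* M′ → SN M′
SN-→β* s        ε        = s
SN-→β* (sn red) (r ◅ rs) = SN-→β* (red r) rs

SN-var : ∀ {x} → SN (var x)
SN-var = sn λ ()

SN-lam : ∀ {M} → SN M → SN (lam M)
SN-lam (sn red) = sn λ { (abs r) → SN-lam (red r) }

SN-·ˡ : ∀ {M N} → SN (M · N) → SN M
SN-·ˡ (sn red) = sn λ r → SN-·ˡ (red (appL r))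

SN-·ʳ : ∀ {M N} → SN (M · N) → SN N
SN-·ʳ (sn red) = sn λ r → SN-·ʳ (red (appR r))

SN-apps⁻ : ∀ Ns {H} → SN (apps H Ns) → SN H × All SN Ns
SN-apps⁻ []       s = s , []
SN-apps⁻ (N ∷ Ns) s with SN-apps⁻ Ns s
... | sHN , sNs = SN-·ˡ sHN , SN-·ʳ sHN ∷ sNs

data Neutral : Term → Set where
  var : ∀ {x} → Neutral (var x)
  _·_ : ∀ {H} → Neutral H → ∀ N → Neutral (H · N)

Neutral-→β : ∀ {H H′} → Neutral H → H →β H′ → Neutral H′
Neutral-→β (n · N) (appL r) = Neutral-→β n r · N
Neutral-→β (n · _) (appR r) = n · _

SN-neutral-· : ∀ {H N} → Neutral H → SN H → SN N → SN (H · N)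
SN-neutral-· n (sn redH) (sn redN) = sn λ
  { (appL r) → SN-neutral-· (Neutral-→β n r) (redH r) (sn redN)
  ; (appR r) → SN-neutral-· n (sn redH) (redN r)
  }

SN-neutral-apps : ∀ Ns {H} → Neutral H → SN H → All SN Ns → SN (apps H Ns)
SN-neutral-apps []       n s []          = s
SN-neutral-apps (N ∷ Ns) n s (sN ∷ sNs) = SN-neutral-apps Ns (n · N) (SN-neutral-· n s sN) sNs

SN-var-apps : ∀ {x} Ns → All SN Ns → SN (apps (var x) Ns)
SN-var-apps Ns = SN-neutral-apps Ns var SN-var

-- Lexicographic induction on SN N and SN (apps (M [ N ]) Ns).
SN-β-expand : ∀ {M N} Ns → SN N → SN (apps (M [ N ]) Ns) → SN (apps (lam M · N) Ns)
SN-β-expand-reduct : ∀ {M N} Ns {T} → SN N → SN (apps (M [ N ]) Ns) →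
                     AppsReduct (lam M · N) Ns T → SN T

SN-β-expand Ns sN s = sn λ r → SN-β-expand-reduct Ns sN s (apps-·-reduct Ns r)

SN-β-expand-reduct Ns sN s (head β) = s
SN-β-expand-reduct {N = N} Ns sN (sn red) (head (appL (abs r))) =
  SN-β-expand Ns sN (red (apps-→β-head Ns (subst-→β (sub0 N) r)))
SN-β-expand-reduct {M} {N} Ns (sn redN) s (head (appR {N′ = N′} r)) =
  SN-β-expand Ns (redN r) (SN-→β* s (gmap (λ X → apps X Ns) (apps-→β-head Ns) contractum-→β*))
  where
  sub0-→β* : ∀ x → sub0 N x →β* sub0 N′ x
  sub0-→β* zero    = r ◅ ε
  sub0-→β* (suc x) = ε

  contractum-→β* : M [ N ] →β* M [ N′ ]
  contractum-→β* = subst-→β* sub0-→β* M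
SN-β-expand-reduct {M} {N} Ns sN (sn red) (args {Ns′} rs) =
  SN-β-expand {M} Ns′ sN (red (apps-→β-args (M [ N ]) rs))

theorem1 : ∀ {Γ : Ctx} {M : Term} {A : Ty} → Γ ⊢ₛ M ∶ A → SN M
theorem1 (Ax _)                  = SN-var
theorem1 (Beta {Ns = Ns} ⊢MN ⊢N) = SN-β-expand Ns (theorem1 ⊢N) (theorem1 ⊢MN)
theorem1 (L⇒ {Ns = Ns} ⊢N ⊢yNs _ _ _) =
  SN-var-apps (_ ∷ Ns) (theorem1 ⊢N ∷ proj₂ (SN-apps⁻ Ns (theorem1 ⊢yNs)))
theorem1 (R⇒ ⊢M)                 = SN-lam (theorem1 ⊢M)
theorem1 (L∩ ⊢xNs _)             = theorem1 ⊢xNs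
theorem1 (R∩ ⊢M _)               = theorem1 ⊢M
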